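{- Let $C$ be a groupoid and $Q$ a Dedekind quantale in which binary inf distributes over all sups. Then $Q^C$, with pointwise order and lattice operations, convolution $\ast$, unit $\mathit{id}_0$ and involution $f^\circ(x)=(f(x^-))^\circ$, is a Dedekind quantale in which binary inf distributes over all sups.
   Context: A catoid $(C,\odot,s,t)$ is a set with $\odot:C\times C\to\mathcal P C$ and $s,t:C\to C$ such that, with $X\odot Y=\bigcup_{x\in X,y\in Y}x\odot y$: $x\odot(y\odot z)=(x\odot y)\odot z$, $x\odot y\ne\emptyset\Rightarrow t(x)=s(y)$, $s(x)\odot x=\{x\}$, $x\odot t(x)=\{x\}$. A groupoid is a catoid with $(-)^-:C\to C$ such that $x\odot x^-=\{s(x)\}$ and $x^-\odot x=\{t(x)\}$. A quantale is a complete lattice with an associative multiplication preserving all sups in both arguments and having a unit $1$. An involutive quantale is a quantale with $(-)^\circ$ satisfying $\alpha^{\circ\circ}=\alpha$, $(\bigvee A)^\circ=\bigvee\{\alpha^\circ\mid\alpha\in A\}$, $(\alpha\beta)^\circ=\beta^\circ\alpha^\circ$. A Dedekind quantale is an involutive quantale satisfying $\alpha\beta\wedge\gamma\le(\alpha\wedge\gamma\beta^\circ)(\beta\wedge\alpha^\circ\gamma)$. Binary inf distributes over all sups means $\alpha\wedge\bigvee B=\bigvee\{\alpha\wedge\beta\mid\beta\in B\}$. On $Q^C$: $(f\ast g)(x)=\bigvee\{f(y)\cdot g(z)\mid x\in y\odot z\}$, and $\mathit{id}_0(x)=1$ if $s(x)=x$, $\bot$ otherwise. -}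

module Defs where

open import Level using (Level; _⊔_; suc)
open import Data.Product using (Σ; ∃; _×_; _,_; proj₁; proj₂)
open import Function.Bundles using (_⇔_)
open import Relation.Binary.Core using (Rel)
open import Relation.Binary.Structures using (IsPartialOrder)
open import Relation.Binary.PropositionalEquality using (_≡_)

-- Catoids and groupoids.
-- The multioperation ⊙ : C × C → 𝒫 C is given as a ternary relation:
-- Mul x y z  means  z ∈ x ⊙ y.

record IsCatoid {ι : Level} (C : Set ι) (Mul : C → C → C → Set ι)
                (s t : C → C) : Set ι where
  field
    assoc    : ∀ x y z w →
               (∃ λ v → Mul y z v × Mul x v w) ⇔ (∃ λ u → Mul x y u × Mul u z w)
    local    : ∀ x y z → Mul x y z → t x ≡ s y
    s-unit   : ∀ x z → Mul (s x) x z ⇔ (z ≡ x)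
    t-unit   : ∀ x z → Mul x (t x) z ⇔ (z ≡ x)

record Groupoid (ι : Level) : Set (suc ι) where
  field
    Carrier   : Set ι
    Mul       : Carrier → Carrier → Carrier → Set ι
    s t       : Carrier → Carrier
    isCatoid  : IsCatoid Carrier Mul s t
    inv       : Carrier → Carrier
    inv-right : ∀ x z → Mul x (inv x) z ⇔ (z ≡ s x)
    inv-left  : ∀ x z → Mul (inv x) x z ⇔ (z ≡ t x)

-- Complete lattices / quantales, over a setoid equality _≈_.
-- Subsets are represented by families indexed by types I : Set ι.

Sup : {a : Level} (ι : Level) (A : Set a) → Set (a ⊔ suc ι)
Sup ι A = {I : Set ι} → (I → A) → A

module _ {a e ι : Level} {A : Set a} where

  record IsCompleteLattice (_≈_ _≤_ : Rel A e) (⋁ : Sup ι A) (_∧_ : A → A → A)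
         : Set (a ⊔ e ⊔ suc ι) where
    field
      isPartialOrder : IsPartialOrder _≈_ _≤_
      ⋁-upper : ∀ {I : Set ι} (f : I → A) (i : I) → f i ≤ ⋁ f
      ⋁-least : ∀ {I : Set ι} (f : I → A) (x : A) → (∀ i → f i ≤ x) → ⋁ f ≤ x
      ∧-lower₁ : ∀ x y → (x ∧ y) ≤ x
      ∧-lower₂ : ∀ x y → (x ∧ y) ≤ y
      ∧-greatest : ∀ x y z → z ≤ x → z ≤ y → z ≤ (x ∧ y)

  record IsQuantale (_≈_ _≤_ : Rel A e) (⋁ : Sup ι A) (_∧_ : A → A → A)
         (_·_ : A → A → A) (𝟙 : A) : Set (a ⊔ e ⊔ suc ι) where
    field
      isCompleteLattice : IsCompleteLattice _≈_ _≤_ ⋁ _∧_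
      ·-cong   : ∀ {x x′ y y′} → x ≈ x′ → y ≈ y′ → (x · y) ≈ (x′ · y′)
      ·-assoc  : ∀ x y z → ((x · y) · z) ≈ (x · (y · z))
      ·-identityˡ : ∀ x → (𝟙 · x) ≈ x
      ·-identityʳ : ∀ x → (x · 𝟙) ≈ x
      ·-distribˡ-⋁ : ∀ x {I : Set ι} (f : I → A) → (x · ⋁ f) ≈ ⋁ (λ i → x · f i)
      ·-distribʳ-⋁ : ∀ x {I : Set ι} (f : I → A) → (⋁ f · x) ≈ ⋁ (λ i → f i · x)

  record IsInvolutiveQuantale (_≈_ _≤_ : Rel A e) (⋁ : Sup ι A) (_∧_ : A → A → A)
         (_·_ : A → A → A) (𝟙 : A) (_° : A → A) : Set (a ⊔ e ⊔ suc ι) where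
    field
      isQuantale : IsQuantale _≈_ _≤_ ⋁ _∧_ _·_ 𝟙
      °-cong     : ∀ {x y} → x ≈ y → (x °) ≈ (y °)
      °-involutive : ∀ x → ((x °) °) ≈ x
      °-⋁        : ∀ {I : Set ι} (f : I → A) → ((⋁ f) °) ≈ ⋁ (λ i → (f i) °)
      °-·        : ∀ x y → ((x · y) °) ≈ ((y °) · (x °))

  record IsDedekindQuantale (_≈_ _≤_ : Rel A e) (⋁ : Sup ι A) (_∧_ : A → A → A)
         (_·_ : A → A → A) (𝟙 : A) (_° : A → A) : Set (a ⊔ e ⊔ suc ι) where
    field
      isInvolutiveQuantale : IsInvolutiveQuantale _≈_ _≤_ ⋁ _∧_ _·_ 𝟙 _°
      dedekind : ∀ α β γ →
        ((α · β) ∧ γ) ≤ ((α ∧ (γ · (β °))) · (β ∧ ((α °) · γ)))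

  InfDistrib : (_≈_ : Rel A e) (⋁ : Sup ι A) (_∧_ : A → A → A) → Set (a ⊔ e ⊔ suc ι)
  InfDistrib _≈_ ⋁ _∧_ =
    ∀ x {I : Set ι} (f : I → A) → (x ∧ ⋁ f) ≈ ⋁ (λ i → x ∧ f i)

record DedekindQuantale (a e ι : Level) : Set (suc (a ⊔ e ⊔ ι)) where
  infix 4 _≈_ _≤_
  field
    Carrier : Set a
    _≈_ _≤_ : Rel Carrier e
    ⋁       : Sup ι Carrier
    _∧_     : Carrier → Carrier → Carrier
    _·_     : Carrier → Carrier → Carrier
    𝟙       : Carrier
    _°      : Carrier → Carrier
    isDedekindQuantale : IsDedekindQuantale _≈_ _≤_ ⋁ _∧_ _·_ 𝟙 _°

module FunctionQuantale {a e ι : Level} (G : Groupoid ι) (Q : DedekindQuantale a e ι) where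
  open Groupoid G renaming (Carrier to C)
  open DedekindQuantale Q renaming (Carrier to A)

  F : Set (a ⊔ ι)
  F = C → A

  _≈ᶠ_ : Rel F (ι ⊔ e)
  f ≈ᶠ g = ∀ x → f x ≈ g x

  _≤ᶠ_ : Rel F (ι ⊔ e)
  f ≤ᶠ g = ∀ x → f x ≤ g x

  ⋁ᶠ : Sup ι F
  ⋁ᶠ h x = ⋁ (λ i → h i x)

  _∧ᶠ_ : F → F → F
  (f ∧ᶠ g) x = f x ∧ g x

  _∗_ : F → F → F
  (f ∗ g) x = ⋁ {I = Σ (C × C) (λ p → Mul (proj₁ p) (proj₂ p) x)}
                (λ i → f (proj₁ (proj₁ i)) · g (proj₂ (proj₁ i)))

  -- id₀(x) = 1 if s(x) = x, ⊥ otherwise;  rendered constructively as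
  -- the sup of the family {1 | s(x) ≡ x}.
  id₀ : F
  id₀ x = ⋁ {I = s x ≡ x} (λ _ → 𝟙)

  _°ᶠ : F → F
  (f °ᶠ) x = (f (inv x)) °

{-# OPTIONS --safe #-}
module Submission where

open import Defs
open import Data.Bool using (Bool; true; false)
open import Data.Product using (Σ; _×_; _,_; proj₁; proj₂)
open import Function.Bundles using (Equivalence)
open import Level using (Level; Lift; lift)
open import Relation.Binary.Bundles using (Poset)
open import Relation.Binary.Core using (Rel)
open import Relation.Binary.PropositionalEquality as ≡ using (_≡_; subst)
open import Relation.Binary.Structures using (IsPartialOrder)

-- Everything on Q^C is computed pointwise; the only work is reindexing the
-- sups defining convolution. Associativity and units of ∗ come from those of
-- the catoid, the involution law from  x ∈ y ⊙ z ⇒ x⁻ ∈ z⁻ ⊙ y⁻,  and the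
-- Dedekind law from distributing h x ∧_ over the sup (f ∗ g) x and applying
-- the Dedekind law of Q to each term f y · g z, using the rotations
-- x ∈ y ⊙ z ⇒ y ∈ x ⊙ z⁻ and z ∈ y⁻ ⊙ x.

module CatoidProperties {ι : Level} {C : Set ι} {Mul : C → C → C → Set ι} {s t : C → C}
                        (isCatoid : IsCatoid C Mul s t) where
  open IsCatoid isCatoid
  open Equivalence

  Mul-s : ∀ x → Mul (s x) x x
  Mul-s x = from (s-unit x x) ≡.refl

  Mul-t : ∀ x → Mul x (t x) x
  Mul-t x = from (t-unit x x) ≡.refl

  t-s≡s : ∀ x → t (s x) ≡ s x
  t-s≡s x = local (s x) x x (Mul-s x)

  s-t≡t : ∀ x → s (t x) ≡ t x
  s-t≡t x = ≡.sym (local x (t x) x (Mul-t x))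

  s-fixed⇒t-fixed : ∀ {y} → s y ≡ y → t y ≡ y
  s-fixed⇒t-fixed {y} sy≡y = subst (λ w → t w ≡ w) sy≡y (t-s≡s y)

  Mul-unitˡ : ∀ {y z x} → Mul y z x → s y ≡ y → z ≡ x
  Mul-unitˡ {y} {z} {x} m sy≡y = ≡.sym (to (s-unit z x) (subst (λ w → Mul w z x) y≡sz m))
    where
    y≡sz : y ≡ s z
    y≡sz = ≡.trans (≡.sym (s-fixed⇒t-fixed sy≡y)) (local y z x m)

  Mul-unitʳ : ∀ {y z x} → Mul y z x → s z ≡ z → y ≡ x
  Mul-unitʳ {y} {z} {x} m sz≡z = ≡.sym (to (t-unit y x) (subst (λ w → Mul y w x) z≡ty m))
    where
    z≡ty : z ≡ t y
    z≡ty = ≡.sym (≡.trans (local y z x m) sz≡z)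

  s-s≡s : ∀ x → s (s x) ≡ s x
  s-s≡s x = ≡.trans (≡.sym (local (s x) (s x) (s x) sxsx∋sx)) (t-s≡s x)
    where
    sxsx∋sx : Mul (s x) (s x) (s x)
    sxsx∋sx = subst (λ w → Mul (s x) w (s x)) (t-s≡s x) (Mul-t (s x))

  s-Mul : ∀ {x y z} → Mul x y z → s z ≡ s x
  s-Mul {x} {y} {z} m with from (assoc (s x) x y z) (x , Mul-s x , m)
  ... | v , _ , m₂ = ≡.trans (≡.cong s (≡.sym (Mul-unitˡ m₂ (s-s≡s x))))
                              (≡.trans (≡.sym (local (s x) v z m₂)) (t-s≡s x))

  t-Mul : ∀ {x y z} → Mul x y z → t z ≡ t y
  t-Mul {x} {y} {z} m with to (assoc x y (t y) z) (y , Mul-t y , m)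
  ... | u , _ , m₂ = ≡.trans (≡.cong t (≡.sym (Mul-unitʳ m₂ (s-t≡t y))))
                              (≡.trans (local u (t y) z m₂) (s-t≡t y))

module GroupoidProperties {ι : Level} (G : Groupoid ι) where
  open Groupoid G
  open IsCatoid isCatoid
  open CatoidProperties isCatoid public
  open Equivalence

  -- z is the only element of y⁻ ⊙ (y ⊙ z) = t y ⊙ z, and y⁻ ⊙ w is nonempty
  -- because  w ∈ s y ⊙ w ⊆ (y ⊙ y⁻) ⊙ w.
  Mul-invˡ : ∀ {y z w} → Mul y z w → Mul (inv y) w z
  Mul-invˡ {y} {z} {w} m with from (assoc y (inv y) w w)
                                   (s y , from (inv-right y (s y)) ≡.refl ,
                                    subst (λ q → Mul q w w) (s-Mul m) (Mul-s w))
  ... | v , y⁻w∋v , _ with to (assoc (inv y) y z v) (w , m , y⁻w∋v)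
  ...   | u , y⁻y∋u , uz∋v = subst (Mul (inv y) w) (≡.sym (Mul-unitˡ tyz∋v (s-t≡t y))) y⁻w∋v
    where
    tyz∋v : Mul (t y) z v
    tyz∋v = subst (λ q → Mul q z v) (to (inv-left y u) y⁻y∋u) uz∋v

  Mul-invʳ : ∀ {y z w} → Mul y z w → Mul w (inv z) y
  Mul-invʳ {y} {z} {w} m with to (assoc w (inv z) z w)
                                 (t z , from (inv-left z (t z)) ≡.refl ,
                                  subst (λ q → Mul w q w) (t-Mul m) (Mul-t w))
  ... | u , wz⁻∋u , _ with from (assoc y z (inv z) u) (w , m , wz⁻∋u)
  ...   | v , zz⁻∋v , yv∋u = subst (Mul w (inv z)) (≡.sym (Mul-unitʳ ysz∋u (s-s≡s z))) wz⁻∋u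
    where
    ysz∋u : Mul y (s z) u
    ysz∋u = subst (λ q → Mul y q u) (to (inv-right z v) zz⁻∋v) yv∋u

  inv-involutive : ∀ x → inv (inv x) ≡ x
  inv-involutive x = Mul-unitˡ (Mul-invʳ (from (inv-right x (s x)) ≡.refl)) (s-s≡s x)

  Mul-inv : ∀ {y z w} → Mul y z w → Mul (inv z) (inv y) (inv w)
  Mul-inv m = Mul-invʳ (Mul-invˡ (Mul-invʳ m))

module CompleteLatticeProperties
  {a e ι : Level} {A : Set a} {_≈_ _≤_ : Rel A e} {⋁ : Sup ι A} {_∧_ : A → A → A}
  (isCompleteLattice : IsCompleteLattice _≈_ _≤_ ⋁ _∧_) where
  open IsCompleteLattice isCompleteLattice
  open IsPartialOrder isPartialOrder

  poset : Poset a e e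
  poset = record { isPartialOrder = isPartialOrder }

  ⋁-mono : ∀ {I : Set ι} {f g : I → A} → (∀ i → f i ≤ g i) → ⋁ f ≤ ⋁ g
  ⋁-mono {g = g} f≤g = ⋁-least _ _ (λ i → trans (f≤g i) (⋁-upper g i))

  ⋁-cong : ∀ {I : Set ι} {f g : I → A} → (∀ i → f i ≈ g i) → ⋁ f ≈ ⋁ g
  ⋁-cong f≈g = antisym (⋁-mono (λ i → reflexive (f≈g i)))
                       (⋁-mono (λ i → reflexive (Eq.sym (f≈g i))))

  ∧-mono : ∀ {x x′ y y′} → x ≤ x′ → y ≤ y′ → (x ∧ y) ≤ (x′ ∧ y′)
  ∧-mono p q = ∧-greatest _ _ _ (trans (∧-lower₁ _ _) p) (trans (∧-lower₂ _ _) q)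

  ∧-congˡ : ∀ {x y y′} → y ≈ y′ → (x ∧ y) ≈ (x ∧ y′)
  ∧-congˡ p = antisym (∧-mono refl (reflexive p)) (∧-mono refl (reflexive (Eq.sym p)))

  ∧-comm : ∀ x y → (x ∧ y) ≈ (y ∧ x)
  ∧-comm x y = antisym (∧-greatest _ _ _ (∧-lower₂ _ _) (∧-lower₁ _ _))
                       (∧-greatest _ _ _ (∧-lower₂ _ _) (∧-lower₁ _ _))

  -- x ≤ y makes y the sup of the two-element family {x, y}.
  ⋁-preserving⇒monotone : (φ : A → A) → (∀ {x y} → x ≈ y → φ x ≈ φ y) →
    (∀ {I : Set ι} (f : I → A) → φ (⋁ f) ≈ ⋁ (λ i → φ (f i))) →
    ∀ {x y} → x ≤ y → φ x ≤ φ y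
  ⋁-preserving⇒monotone φ φ-cong φ-⋁ {x} {y} x≤y =
    trans (⋁-upper (λ i → φ (pair i)) (lift true))
          (reflexive (Eq.trans (Eq.sym (φ-⋁ pair)) (φ-cong ⋁pair≈y)))
    where
    pair : Lift ι Bool → A
    pair (lift true)  = x
    pair (lift false) = y

    ⋁pair≈y : ⋁ pair ≈ y
    ⋁pair≈y = antisym (⋁-least pair y λ { (lift true) → x≤y ; (lift false) → refl })
                      (⋁-upper pair (lift false))

module QuantaleProperties
  {a e ι : Level} {A : Set a} {_≈_ _≤_ : Rel A e} {⋁ : Sup ι A} {_∧_ _·_ : A → A → A} {𝟙 : A}
  (isQuantale : IsQuantale _≈_ _≤_ ⋁ _∧_ _·_ 𝟙) where
  open IsQuantale isQuantale
  open IsCompleteLattice isCompleteLattice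
  open IsPartialOrder isPartialOrder
  open CompleteLatticeProperties isCompleteLattice

  ·-mono : ∀ {x x′ y y′} → x ≤ x′ → y ≤ y′ → (x · y) ≤ (x′ · y′)
  ·-mono {x′ = x′} {y = y} p q =
    trans (⋁-preserving⇒monotone (_· y) (λ r → ·-cong r Eq.refl) (·-distribʳ-⋁ y) p)
          (⋁-preserving⇒monotone (x′ ·_) (·-cong Eq.refl) (·-distribˡ-⋁ x′) q)

  ⋁·-least : ∀ {I : Set ι} {f : I → A} {y z} → (∀ i → (f i · y) ≤ z) → (⋁ f · y) ≤ z
  ⋁·-least {y = y} bound = trans (reflexive (·-distribʳ-⋁ y _)) (⋁-least _ _ bound)

  ·⋁-least : ∀ {I : Set ι} {f : I → A} {x z} → (∀ i → (x · f i) ≤ z) → (x · ⋁ f) ≤ z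
  ·⋁-least {x = x} bound = trans (reflexive (·-distribˡ-⋁ x _)) (⋁-least _ _ bound)

module FunctionQuantaleProperties {a e ι : Level} (G : Groupoid ι) (Q : DedekindQuantale a e ι) where
  open FunctionQuantale G Q
  open Groupoid G renaming (Carrier to C)
  open IsCatoid isCatoid using (assoc)
  open GroupoidProperties G
  open Equivalence using (from; to)
  open DedekindQuantale Q renaming (Carrier to A)
  open IsDedekindQuantale isDedekindQuantale
  open IsInvolutiveQuantale isInvolutiveQuantale
  open IsQuantale isQuantale
  open IsCompleteLattice isCompleteLattice
  open IsPartialOrder isPartialOrder
  open CompleteLatticeProperties isCompleteLattice
  open QuantaleProperties isQuantale
  open import Relation.Binary.Reasoning.PartialOrder poset

  ≡⇒≈ᶠ : (f : F) {u v : C} → u ≡ v → f u ≈ f v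
  ≡⇒≈ᶠ f eq = Eq.reflexive (≡.cong f eq)

  °ᶠ-inv : ∀ f x → (f °ᶠ) (inv x) ≈ (f x °)
  °ᶠ-inv f x = °-cong (≡⇒≈ᶠ f (inv-involutive x))

  ∗-upper : ∀ {f g : F} {y z x} → Mul y z x → (f y · g z) ≤ (f ∗ g) x
  ∗-upper m = ⋁-upper _ ((_ , _) , m)

  ∗-least : ∀ {f g : F} {x c} → (∀ {y z} → Mul y z x → (f y · g z) ≤ c) → (f ∗ g) x ≤ c
  ∗-least bound = ⋁-least _ _ (λ { ((y , z) , m) → bound m })

  isCompleteLatticeᶠ : IsCompleteLattice _≈ᶠ_ _≤ᶠ_ ⋁ᶠ _∧ᶠ_
  isCompleteLatticeᶠ = record
    { isPartialOrder = record
      { isPreorder = record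
        { isEquivalence = record
          { refl  = λ _ → Eq.refl
          ; sym   = λ p x → Eq.sym (p x)
          ; trans = λ p q x → Eq.trans (p x) (q x)
          }
        ; reflexive = λ p x → reflexive (p x)
        ; trans     = λ p q x → trans (p x) (q x)
        }
      ; antisym = λ p q x → antisym (p x) (q x)
      }
    ; ⋁-upper    = λ f i x → ⋁-upper (λ j → f j x) i
    ; ⋁-least    = λ f g bound x → ⋁-least (λ j → f j x) (g x) (λ i → bound i x)
    ; ∧-lower₁   = λ f g x → ∧-lower₁ (f x) (g x)
    ; ∧-lower₂   = λ f g x → ∧-lower₂ (f x) (g x)
    ; ∧-greatest = λ f g h p q x → ∧-greatest (f x) (g x) (h x) (p x) (q x)
    }

  ∗-assoc-≤ : ∀ f g h x → ((f ∗ g) ∗ h) x ≤ (f ∗ (g ∗ h)) x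
  ∗-assoc-≤ f g h x = ∗-least λ {u} {z} uz∋x → ⋁·-least λ { ((y₁ , y₂) , y₁y₂∋u) →
    let (v , y₂z∋v , y₁v∋x) = from (assoc y₁ y₂ z x) (u , y₁y₂∋u , uz∋x) in
    begin
      (f y₁ · g y₂) · h z    ≈⟨ ·-assoc _ _ _ ⟩
      f y₁ · (g y₂ · h z)    ≤⟨ ·-mono refl (∗-upper y₂z∋v) ⟩
      f y₁ · (g ∗ h) v       ≤⟨ ∗-upper y₁v∋x ⟩
      (f ∗ (g ∗ h)) x        ∎ }

  ∗-assoc-≥ : ∀ f g h x → (f ∗ (g ∗ h)) x ≤ ((f ∗ g) ∗ h) x
  ∗-assoc-≥ f g h x = ∗-least λ {y} {v} yv∋x → ·⋁-least λ { ((z₁ , z₂) , z₁z₂∋v) →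
    let (u , yz₁∋u , uz₂∋x) = to (assoc y z₁ z₂ x) (v , z₁z₂∋v , yv∋x) in
    begin
      f y · (g z₁ · h z₂)    ≈⟨ ·-assoc _ _ _ ⟨
      (f y · g z₁) · h z₂    ≤⟨ ·-mono (∗-upper yz₁∋u) refl ⟩
      (f ∗ g) u · h z₂       ≤⟨ ∗-upper uz₂∋x ⟩
      ((f ∗ g) ∗ h) x        ∎ }

  ∗-identityˡ : ∀ f → (id₀ ∗ f) ≈ᶠ f
  ∗-identityˡ f x = antisym
    (∗-least λ yz∋x → ⋁·-least λ sy≡y →
      trans (reflexive (·-identityˡ _)) (reflexive (≡⇒≈ᶠ f (Mul-unitˡ yz∋x sy≡y))))
    (begin
      f x              ≈⟨ ·-identityˡ _ ⟨
      𝟙 · f x          ≤⟨ ·-mono (⋁-upper (λ _ → 𝟙) (s-s≡s x)) refl ⟩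
      id₀ (s x) · f x  ≤⟨ ∗-upper (Mul-s x) ⟩
      (id₀ ∗ f) x      ∎)

  ∗-identityʳ : ∀ f → (f ∗ id₀) ≈ᶠ f
  ∗-identityʳ f x = antisym
    (∗-least λ yz∋x → ·⋁-least λ sz≡z →
      trans (reflexive (·-identityʳ _)) (reflexive (≡⇒≈ᶠ f (Mul-unitʳ yz∋x sz≡z))))
    (begin
      f x              ≈⟨ ·-identityʳ _ ⟨
      f x · 𝟙          ≤⟨ ·-mono refl (⋁-upper (λ _ → 𝟙) (s-t≡t x)) ⟩
      f x · id₀ (t x)  ≤⟨ ∗-upper (Mul-t x) ⟩
      (f ∗ id₀) x      ∎)

  ∗-distribˡ-⋁ᶠ : ∀ f {I : Set ι} (h : I → F) → (f ∗ ⋁ᶠ h) ≈ᶠ ⋁ᶠ (λ i → f ∗ h i)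
  ∗-distribˡ-⋁ᶠ f h x = antisym
    (∗-least λ yz∋x → ·⋁-least λ i → trans (∗-upper yz∋x) (⋁-upper (λ j → (f ∗ h j) x) i))
    (⋁-least _ _ λ i → ∗-least λ yz∋x → trans (·-mono refl (⋁-upper (λ j → h j _) i)) (∗-upper yz∋x))

  ∗-distribʳ-⋁ᶠ : ∀ f {I : Set ι} (h : I → F) → (⋁ᶠ h ∗ f) ≈ᶠ ⋁ᶠ (λ i → h i ∗ f)
  ∗-distribʳ-⋁ᶠ f h x = antisym
    (∗-least λ yz∋x → ⋁·-least λ i → trans (∗-upper yz∋x) (⋁-upper (λ j → (h j ∗ f) x) i))
    (⋁-least _ _ λ i → ∗-least λ yz∋x → trans (·-mono (⋁-upper (λ j → h j _) i) refl) (∗-upper yz∋x))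

  isQuantaleᶠ : IsQuantale _≈ᶠ_ _≤ᶠ_ ⋁ᶠ _∧ᶠ_ _∗_ id₀
  isQuantaleᶠ = record
    { isCompleteLattice = isCompleteLatticeᶠ
    ; ·-cong       = λ p q x → ⋁-cong (λ _ → ·-cong (p _) (q _))
    ; ·-assoc      = λ f g h x → antisym (∗-assoc-≤ f g h x) (∗-assoc-≥ f g h x)
    ; ·-identityˡ  = ∗-identityˡ
    ; ·-identityʳ  = ∗-identityʳ
    ; ·-distribˡ-⋁ = ∗-distribˡ-⋁ᶠ
    ; ·-distribʳ-⋁ = ∗-distribʳ-⋁ᶠ
    }

  °ᶠ-∗ : ∀ f g → ((f ∗ g) °ᶠ) ≈ᶠ ((g °ᶠ) ∗ (f °ᶠ))
  °ᶠ-∗ f g x = begin-equality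
    ((f ∗ g) °ᶠ) x                                           ≈⟨ °-⋁ _ ⟩
    ⋁ (λ i → (f (proj₁ (proj₁ i)) · g (proj₂ (proj₁ i))) °)  ≈⟨ ⋁-cong (λ _ → °-· _ _) ⟩
    ⋁ reversed                                               ≈⟨ antisym reversed≤ reversed≥ ⟩
    ((g °ᶠ) ∗ (f °ᶠ)) x                                      ∎
    where
    Index : Set ι
    Index = Σ (C × C) (λ p → Mul (proj₁ p) (proj₂ p) (inv x))

    reversed : Index → A
    reversed ((y , z) , _) = (g z °) · (f y °)

    reversed≤ : ⋁ reversed ≤ ((g °ᶠ) ∗ (f °ᶠ)) x
    reversed≤ = ⋁-least _ _ λ { ((y , z) , yz∋x⁻) →
      begin
        (g z °) · (f y °)                  ≈⟨ ·-cong (°ᶠ-inv g z) (°ᶠ-inv f y) ⟨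
        (g °ᶠ) (inv z) · (f °ᶠ) (inv y)    ≤⟨ ∗-upper (subst (Mul (inv z) (inv y)) (inv-involutive x) (Mul-inv yz∋x⁻)) ⟩
        ((g °ᶠ) ∗ (f °ᶠ)) x                ∎ }

    reversed≥ : ((g °ᶠ) ∗ (f °ᶠ)) x ≤ ⋁ reversed
    reversed≥ = ∗-least λ yz∋x → ⋁-upper reversed ((_ , _) , Mul-inv yz∋x)

  isInvolutiveQuantaleᶠ : IsInvolutiveQuantale _≈ᶠ_ _≤ᶠ_ ⋁ᶠ _∧ᶠ_ _∗_ id₀ _°ᶠ
  isInvolutiveQuantaleᶠ = record
    { isQuantale   = isQuantaleᶠ
    ; °-cong       = λ p x → °-cong (p (inv x))
    ; °-involutive = λ f x → Eq.trans (°-involutive _) (≡⇒≈ᶠ f (inv-involutive x))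
    ; °-⋁          = λ h x → °-⋁ (λ i → h i (inv x))
    ; °-·          = °ᶠ-∗
    }

  module _ (∧-distribˡ-⋁ : InfDistrib _≈_ ⋁ _∧_) where

    ∧ᶠ-distribˡ-⋁ᶠ : InfDistrib _≈ᶠ_ ⋁ᶠ _∧ᶠ_
    ∧ᶠ-distribˡ-⋁ᶠ f h x = ∧-distribˡ-⋁ (f x) (λ i → h i x)

    dedekindᶠ : ∀ f g h → ((f ∗ g) ∧ᶠ h) ≤ᶠ ((f ∧ᶠ (h ∗ (g °ᶠ))) ∗ (g ∧ᶠ ((f °ᶠ) ∗ h)))
    dedekindᶠ f g h x = begin
      (f ∗ g) x ∧ h x                                              ≈⟨ ∧-comm _ _ ⟩
      h x ∧ (f ∗ g) x                                              ≈⟨ ∧-distribˡ-⋁ (h x) _ ⟩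
      ⋁ (λ i → h x ∧ (f (proj₁ (proj₁ i)) · g (proj₂ (proj₁ i))))  ≤⟨ ⋁-least _ _ (λ { ((y , z) , yz∋x) → termwise yz∋x }) ⟩
      ((f ∧ᶠ (h ∗ (g °ᶠ))) ∗ (g ∧ᶠ ((f °ᶠ) ∗ h))) x                ∎
      where
      termwise : ∀ {y z} → Mul y z x →
                 (h x ∧ (f y · g z)) ≤ ((f ∧ᶠ (h ∗ (g °ᶠ))) ∗ (g ∧ᶠ ((f °ᶠ) ∗ h))) x
      termwise {y} {z} yz∋x = begin
        h x ∧ (f y · g z)                                    ≈⟨ ∧-comm _ _ ⟩
        (f y · g z) ∧ h x                                    ≤⟨ dedekind _ _ _ ⟩
        (f y ∧ (h x · (g z °))) · (g z ∧ ((f y °) · h x))    ≈⟨ ·-cong (∧-congˡ (·-cong Eq.refl (°ᶠ-inv g z)))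
                                                                        (∧-congˡ (·-cong (°ᶠ-inv f y) Eq.refl)) ⟨
        (f y ∧ (h x · (g °ᶠ) (inv z))) · (g z ∧ ((f °ᶠ) (inv y) · h x))
                                                             ≤⟨ ·-mono (∧-mono refl (∗-upper (Mul-invʳ yz∋x)))
                                                                       (∧-mono refl (∗-upper (Mul-invˡ yz∋x))) ⟩
        (f ∧ᶠ (h ∗ (g °ᶠ))) y · (g ∧ᶠ ((f °ᶠ) ∗ h)) z         ≤⟨ ∗-upper yz∋x ⟩
        ((f ∧ᶠ (h ∗ (g °ᶠ))) ∗ (g ∧ᶠ ((f °ᶠ) ∗ h))) x          ∎

theorem9p2 : ∀ {a e ι} (G : Groupoid ι) (Q : DedekindQuantale a e ι) →
    InfDistrib (DedekindQuantale._≈_ Q) (DedekindQuantale.⋁ Q) (DedekindQuantale._∧_ Q) →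
    let open FunctionQuantale G Q in
    IsDedekindQuantale _≈ᶠ_ _≤ᶠ_ ⋁ᶠ _∧ᶠ_ _∗_ id₀ _°ᶠ × InfDistrib _≈ᶠ_ ⋁ᶠ _∧ᶠ_
theorem9p2 G Q ∧-distribˡ-⋁ =
  record { isInvolutiveQuantale = isInvolutiveQuantaleᶠ ; dedekind = dedekindᶠ ∧-distribˡ-⋁ } ,
  ∧ᶠ-distribˡ-⋁ᶠ ∧-distribˡ-⋁
  where open FunctionQuantaleProperties G Q
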